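{- Let $m>2\times 10^{31}$ be a positive integer. Then $W(m)<m^{2/9}$.
   Context: $W(m)=2^{\omega(m)}$, where $\omega(m)$ is the number of distinct prime divisors of $m$. -}

module Defs where

open import Data.Nat using (ℕ; suc; _^_)
open import Data.Nat.Divisibility using (_∣?_)
open import Data.Nat.Primality using (prime?)
open import Data.List using (List; upTo; filter; length)
open import Relation.Nullary.Decidable using (_×-dec_)

-- the distinct primes dividing m, listed among 0,1,...,m
-- (every prime divisor of a positive m is ≤ m)
primeDivisors : ℕ → List ℕ
primeDivisors m = filter (λ p → prime? p ×-dec p ∣? m) (upTo (suc m))

ω : ℕ → ℕ
ω m = length (primeDivisors m)

W : ℕ → ℕ
W m = 2 ^ ω m

{-# OPTIONS --safe #-}
-- Let k = ω(m). If k ≤ 23 then W(m)^9 ≤ 2^207 < (2·10^31)^2 < m^2. Otherwise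
-- compare the product of the prime divisors of m, which divides m, with the
-- product 89# of the 24 primes below 97: every prime divisor of m that is at
-- least 97 can pay for one prime below 97 that does not divide m, so
-- 97^k · 89# ≤ m · 97^24. Since 2^9 < 97^2 and 2^216 < (89#)^2 this gives
-- 2^(9k) < m^2.
module Submission where

open import Defs
open import Data.Nat using (ℕ; _*_; _^_; _<_)
open import Data.Nat
  using (zero; suc; _+_; _≤_; s≤s; z≤n; _≤′_; ≤′-refl; ≤′-step; NonZero; >-nonZero)
open import Data.Nat.Properties
open import Algebra.Properties.CommutativeSemigroup *-commutativeSemigroup
  using (interchange; x∙yz≈y∙xz; xy∙z≈zy∙x)
open import Data.Nat.Divisibility using (_∣_; _∣?_; divides; ∣⇒≤; 1∣_)
open import Data.Nat.Primality using (Prime; prime?; euclidsLemma)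
open import Data.Nat.Primality.Factorisation using (factorisationHasAllPrimeFactors)
open import Data.Nat.ListAction using (product)
open import Data.List using (List; []; _∷_; [_]; _++_; upTo; filter; length)
open import Data.List.Properties using (upTo-∷ʳ; filter-++; filter-reject; ++-identityʳ)
open import Data.List.Relation.Unary.All as All using (All; _∷_)
open import Data.List.Relation.Unary.All.Properties using (all-filter; All¬⇒¬Any)
open import Data.List.Relation.Unary.AllPairs using (_∷_)
open import Data.List.Relation.Unary.Unique.Propositional using (Unique)
open import Data.List.Relation.Unary.Unique.Propositional.Properties as Unique using ()
open import Data.Product using (_×_; _,_; proj₁; proj₂)
open import Data.Sum using (inj₁; inj₂)
open import Function using (_∘_)
open import Level using (0ℓ)
open import Relation.Nullary using (¬_; yes; no; contradiction)
open import Relation.Nullary.Decidable using (_×-dec_; toWitness)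
open import Relation.Unary using (Pred; Decidable)
open import Relation.Binary.PropositionalEquality hiding ([_])

^-^-comm : ∀ m n o → (m ^ n) ^ o ≡ (m ^ o) ^ n
^-^-comm m n o = trans (^-*-assoc m n o) (trans (cong (m ^_) (*-comm n o)) (sym (^-*-assoc m o n)))

^-distribʳ-* : ∀ m n o → (m * n) ^ o ≡ m ^ o * n ^ o
^-distribʳ-* m n zero    = refl
^-distribʳ-* m n (suc o) =
  trans (cong (m * n *_) (^-distribʳ-* m n o)) (interchange m n (m ^ o) (n ^ o))

2⁹ᵏ<n²-large : ∀ {b s N} .{{_ : NonZero b}} {k n} → s ≤ k → 2 ^ 9 ≤ b ^ 2 →
               (2 ^ s) ^ 9 < N ^ 2 → b ^ k * N ≤ n * b ^ s → (2 ^ k) ^ 9 < n ^ 2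
2⁹ᵏ<n²-large {b} {s} {N} {n = n} s≤k 2⁹≤b² 2⁹ˢ<N² bᵏN≤nbˢ with m≤n⇒∃[o]m+o≡n s≤k
... | j , refl = begin-strict
  (2 ^ (s + j)) ^ 9         ≡⟨ cong (_^ 9) (^-distribˡ-+-* 2 s j) ⟩
  (2 ^ s * 2 ^ j) ^ 9       ≡⟨ ^-distribʳ-* (2 ^ s) (2 ^ j) 9 ⟩
  (2 ^ s) ^ 9 * (2 ^ j) ^ 9 ≤⟨ *-monoʳ-≤ ((2 ^ s) ^ 9) 2⁹ʲ≤b²ʲ ⟩
  (2 ^ s) ^ 9 * (b ^ j) ^ 2 <⟨ *-monoˡ-< ((b ^ j) ^ 2) {{m^n≢0 (b ^ j) 2 {{m^n≢0 b j}}}} 2⁹ˢ<N² ⟩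
  N ^ 2 * (b ^ j) ^ 2       ≡⟨ ^-distribʳ-* N (b ^ j) 2 ⟨
  (N * b ^ j) ^ 2           ≤⟨ ^-monoˡ-≤ 2 N*bʲ≤n ⟩
  n ^ 2                     ∎
  where
  open ≤-Reasoning
  2⁹ʲ≤b²ʲ : (2 ^ j) ^ 9 ≤ (b ^ j) ^ 2
  2⁹ʲ≤b²ʲ = subst₂ _≤_ (^-^-comm 2 9 j) (^-^-comm b 2 j) (^-monoˡ-≤ j 2⁹≤b²)
  N*bʲ≤n : N * b ^ j ≤ n
  N*bʲ≤n = *-cancelʳ-≤ _ n (b ^ s) {{m^n≢0 b s}} (subst (_≤ n * b ^ s) (begin-equality
    b ^ (s + j) * N     ≡⟨ cong (_* N) (^-distribˡ-+-* b s j) ⟩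
    b ^ s * b ^ j * N   ≡⟨ xy∙z≈zy∙x (b ^ s) (b ^ j) N ⟩
    N * b ^ j * b ^ s   ∎) bᵏN≤nbˢ)

module _ {m : ℕ} where

  p∣m∧n∣m⇒p*n∣m : ∀ {p n} → Prime p → p ∣ m → n ∣ m → ¬ p ∣ n → p * n ∣ m
  p∣m∧n∣m⇒p*n∣m {p} {n} pp p∣m (divides q m≡q*n) p∤n
    with euclidsLemma q n pp (subst (p ∣_) m≡q*n p∣m)
  ... | inj₂ p∣n = contradiction p∣n p∤n
  ... | inj₁ (divides r q≡r*p) = divides r (begin
    m           ≡⟨ m≡q*n ⟩
    q * n       ≡⟨ cong (_* n) q≡r*p ⟩
    r * p * n   ≡⟨ *-assoc r p n ⟩
    r * (p * n) ∎)
    where open ≡-Reasoning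

  product-distinctPrimeDivisors-∣ : ∀ {ps} → Unique ps →
                                    All (λ p → Prime p × p ∣ m) ps → product ps ∣ m
  product-distinctPrimeDivisors-∣ {[]}     _            _                  = 1∣ m
  product-distinctPrimeDivisors-∣ {p ∷ ps} (p∉ps ∷ uniq) ((pp , p∣m) ∷ rest) =
    p∣m∧n∣m⇒p*n∣m pp p∣m (product-distinctPrimeDivisors-∣ uniq rest) p∤Πps
    where
    p∤Πps : ¬ p ∣ product ps
    p∤Πps p∣Πps = All¬⇒¬Any p∉ps
      (factorisationHasAllPrimeFactors pp p∣Πps (All.map proj₁ rest))

module _ {P R : Pred ℕ 0ℓ} (P? : Decidable P) (R? : Decidable R) {b : ℕ}
         (R≤b : ∀ {x} → R x → x ≤ b) (P∖R≥b : ∀ {x} → P x → ¬ R x → b ≤ x) where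

  b^#P*ΠR≤ΠP*b^#R : ∀ xs → b ^ length (filter P? xs) * product (filter R? xs)
                         ≤ product (filter P? xs) * b ^ length (filter R? xs)
  b^#P*ΠR≤ΠP*b^#R []       = ≤-refl
  b^#P*ΠR≤ΠP*b^#R (x ∷ xs) with ih ← b^#P*ΠR≤ΠP*b^#R xs | P? x | R? x
  ... | yes _  | yes _  = subst₂ _≤_ (interchange b x _ _) (interchange x b _ _)
                            (*-mono-≤ (≤-reflexive (*-comm b x)) ih)
  ... | yes px | no ¬rx = subst₂ _≤_ (sym (*-assoc b _ _)) (sym (*-assoc x _ _))
                            (*-mono-≤ (P∖R≥b px ¬rx) ih)
  ... | no _   | yes rx = subst₂ _≤_ (x∙yz≈y∙xz x (b ^ length (filter P? xs)) _)
                                     (x∙yz≈y∙xz b (product (filter P? xs)) _)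
                            (*-mono-≤ (R≤b rx) ih)
  ... | no _   | no _   = ih

module _ {R : Pred ℕ 0ℓ} (R? : Decidable R) {n : ℕ} (R<n : ∀ {x} → R x → x < n) where

  filter-upTo-≤ : ∀ {k} → n ≤ k → filter R? (upTo k) ≡ filter R? (upTo n)
  filter-upTo-≤ = go ∘ ≤⇒≤′
    where
    open ≡-Reasoning
    go : ∀ {k} → n ≤′ k → filter R? (upTo k) ≡ filter R? (upTo n)
    go ≤′-refl = refl
    go (≤′-step {k} n≤′k) = begin
      filter R? (upTo (suc k))              ≡⟨ cong (filter R?) (upTo-∷ʳ k) ⟨
      filter R? (upTo k ++ [ k ])           ≡⟨ filter-++ R? (upTo k) [ k ] ⟩
      filter R? (upTo k) ++ filter R? [ k ] ≡⟨ cong₂ _++_ (go n≤′k) (filter-reject R? ¬Rk) ⟩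
      filter R? (upTo n) ++ []              ≡⟨ ++-identityʳ _ ⟩
      filter R? (upTo n)                    ∎
      where
      ¬Rk : ¬ R k
      ¬Rk Rk = <⇒≱ (R<n Rk) (≤′⇒≤ n≤′k)

smallPrime? : Decidable (λ p → Prime p × p < 97)
smallPrime? p = prime? p ×-dec p <? 97

smallPrimes : List ℕ
smallPrimes = filter smallPrime? (upTo 97)

97^ω*Πsmall≤m*97^24 : ∀ m → 96 ≤ m → 97 ^ ω m * product smallPrimes ≤ m * 97 ^ 24
97^ω*Πsmall≤m*97^24 m m≥96 = begin
  97 ^ ω m * product smallPrimes                 ≡⟨ cong (λ ps → 97 ^ ω m * product ps) small≡ ⟨
  97 ^ ω m * product small                       ≤⟨ b^#P*ΠR≤ΠP*b^#R divisor? smallPrime?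
                                                      (<⇒≤ ∘ proj₂) large (upTo (suc m)) ⟩
  Π * 97 ^ length small                          ≡⟨ cong (λ ps → Π * 97 ^ length ps) small≡ ⟩
  Π * 97 ^ 24                                    ≤⟨ *-monoˡ-≤ (97 ^ 24) Π≤m ⟩
  m * 97 ^ 24                                    ∎
  where
  open ≤-Reasoning
  instance
    _ : NonZero m
    _ = >-nonZero (<-≤-trans (s≤s z≤n) m≥96)
  divisor? : Decidable (λ p → Prime p × p ∣ m)
  divisor? p = prime? p ×-dec p ∣? m
  small : List ℕ
  small = filter smallPrime? (upTo (suc m))
  small≡ : small ≡ smallPrimes
  small≡ = filter-upTo-≤ smallPrime? proj₂ (s≤s m≥96)
  large : ∀ {p} → Prime p × p ∣ m → ¬ (Prime p × p < 97) → 97 ≤ p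
  large (pp , _) ¬small = ≮⇒≥ (¬small ∘ (pp ,_))
  Π : ℕ
  Π = product (primeDivisors m)
  Π≤m : Π ≤ m
  Π≤m = ∣⇒≤ (product-distinctPrimeDivisors-∣ (Unique.filter⁺ divisor? (Unique.upTo⁺ (suc m)))
                                              (all-filter divisor? (upTo (suc m))))

2⁹ᵏ<n²-small : ∀ {k n} → k ≤ 23 → 2 * 10 ^ 31 < n → (2 ^ k) ^ 9 < n ^ 2
2⁹ᵏ<n²-small {k} {n} k≤23 n>2·10³¹ = begin-strict
  (2 ^ k) ^ 9       ≤⟨ ^-monoˡ-≤ 9 (^-monoʳ-≤ 2 k≤23) ⟩
  (2 ^ 23) ^ 9      <⟨ toWitness {a? = (2 ^ 23) ^ 9 <? (2 * 10 ^ 31) ^ 2} _ ⟩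
  (2 * 10 ^ 31) ^ 2 <⟨ ^-monoˡ-< 2 n>2·10³¹ ⟩
  n ^ 2             ∎
  where open ≤-Reasoning

2⁹ᵏ<n² : ∀ k {n} → 2 * 10 ^ 31 < n → 97 ^ k * product smallPrimes ≤ n * 97 ^ 24 →
         (2 ^ k) ^ 9 < n ^ 2
2⁹ᵏ<n² k {n} n>2·10³¹ 97ᵏN≤n97²⁴ with k ≤? 23
... | yes k≤23 = 2⁹ᵏ<n²-small k≤23 n>2·10³¹
-- The constants are given explicitly and kept abstract inside 2⁹ᵏ<n²-large:
-- unifying with the literals instead would make Agda unfold 97 ^ (24 + j) * 89#.
... | no  k≰23 = 2⁹ᵏ<n²-large {97} {24} {product smallPrimes} {k} {n} (≰⇒> k≰23)
                     (toWitness {a? = 2 ^ 9 ≤? 97 ^ 2} _)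
                     (toWitness {a? = (2 ^ 24) ^ 9 <? product smallPrimes ^ 2} _) 97ᵏN≤n97²⁴

lemma4p1 : (m : ℕ) → 2 * 10 ^ 31 < m → W m ^ 9 < m ^ 2
lemma4p1 m m>2·10³¹ = 2⁹ᵏ<n² (ω m) m>2·10³¹ (97^ω*Πsmall≤m*97^24 m m≥96)
  where
  m≥96 : 96 ≤ m
  m≥96 = ≤-trans (toWitness {a? = 96 ≤? 2 * 10 ^ 31} _) (<⇒≤ m>2·10³¹)
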